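{- None of the set-functions $\Downarrow$, $\mathrm{Max}$, $\mathrm{Card}$ is definable by an arithmetic circuit.
   Context: $\mathbb{N}=\{0,1,2,\ldots\}$. For $s,t\subseteq\mathbb{N}$, $s\oplus t=\{m+n\mid m\in s,n\in t\}$ and $s\otimes t=\{mn\mid m\in s,n\in t\}$. An arithmetic circuit $\tau(x)$ is a term built from the variable $x$ (ranging over subsets of $\mathbb{N}$), the constants $\emptyset$, $\mathbb{N}$, $\{n\}$ ($n\in\mathbb{N}$), and $\cup$, $\cap$, complement relative to $\mathbb{N}$, $\oplus$, $\otimes$; it defines the function $s\mapsto\tau(s)$. $\Downarrow(x)=\{m\in\mathbb{N}\mid\exists n\in x,\ m\le n\}$; $\mathrm{Max}(x)=\emptyset$ if $x=\emptyset$, $\mathbb{N}$ if $x$ is infinite, $\{\max x\}$ otherwise; $\mathrm{Card}(x)=\{|x|\}$ if $x$ is finite, $\mathbb{N}$ otherwise. -}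

module Defs where

open import Level using (0ℓ)
open import Data.Nat using (ℕ; _+_; _*_; _≤_)
open import Data.Product using (Σ; _×_; ∃)
open import Data.List using (List; length)
open import Data.List.Relation.Unary.Unique.Propositional using (Unique)
import Data.List.Membership.Propositional as L
open import Function.Bundles using (_⇔_)
open import Relation.Nullary using (¬_)
open import Relation.Binary.PropositionalEquality using (_≡_)
open import Relation.Unary using (Pred; _∈_; _≐_; ∅; U; ｛_｝; _∪_; _∩_; ∁)

SetN : Set₁
SetN = Pred ℕ 0ℓ

_⊕_ : SetN → SetN → SetN
(s ⊕ t) k = Σ ℕ λ m → Σ ℕ λ n → m ∈ s × n ∈ t × k ≡ m + n

_⊗_ : SetN → SetN → SetN
(s ⊗ t) k = Σ ℕ λ m → Σ ℕ λ n → m ∈ s × n ∈ t × k ≡ m * n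

data Circuit : Set where
  var   : Circuit
  emp   : Circuit
  nat   : Circuit
  const : ℕ → Circuit
  cup   : Circuit → Circuit → Circuit
  cap   : Circuit → Circuit → Circuit
  compl : Circuit → Circuit
  plus  : Circuit → Circuit → Circuit
  times : Circuit → Circuit → Circuit

⟦_⟧ : Circuit → SetN → SetN
⟦ var ⟧ s = s
⟦ emp ⟧ s = ∅
⟦ nat ⟧ s = U
⟦ const n ⟧ s = ｛ n ｝
⟦ cup a b ⟧ s = ⟦ a ⟧ s ∪ ⟦ b ⟧ s
⟦ cap a b ⟧ s = ⟦ a ⟧ s ∩ ⟦ b ⟧ s
⟦ compl a ⟧ s = ∁ (⟦ a ⟧ s)
⟦ plus a b ⟧ s = ⟦ a ⟧ s ⊕ ⟦ b ⟧ s
⟦ times a b ⟧ s = ⟦ a ⟧ s ⊗ ⟦ b ⟧ s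

Enumerates : List ℕ → SetN → Set
Enumerates l x = Unique l × (∀ m → (m ∈ x) ⇔ (m L.∈ l))

Finite : SetN → Set
Finite x = Σ (List ℕ) λ l → ∀ m → (m ∈ x) ⇔ (m L.∈ l)

Infinite : SetN → Set
Infinite x = ¬ Finite x

IsMax : SetN → ℕ → Set
IsMax x m = m ∈ x × (∀ n → n ∈ x → n ≤ m)

Down : SetN → SetN
Down x m = Σ ℕ λ n → n ∈ x × m ≤ n

DefinesDown : Circuit → Set₁
DefinesDown τ = ∀ x → ⟦ τ ⟧ x ≐ Down x

DefinesMax : Circuit → Set₁
DefinesMax τ = ∀ x →
  (x ≐ ∅ → ⟦ τ ⟧ x ≐ ∅) ×
  (Infinite x → ⟦ τ ⟧ x ≐ U) ×
  (∀ m → IsMax x m → ⟦ τ ⟧ x ≐ ｛ m ｝)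

DefinesCard : Circuit → Set₁
DefinesCard τ = ∀ x →
  (∀ l → Enumerates l x → ⟦ τ ⟧ x ≐ ｛ length l ｝) ×
  (Infinite x → ⟦ τ ⟧ x ≐ U)

-- Idea: a circuit only sees a bounded window of its input.  If two inputs x, y
-- agree on the segment [0, c], then ⟦ τ ⟧ x and ⟦ τ ⟧ y agree on [0, c] as
-- well, provided the finitely many subcircuits that occur as factors of a
-- product are empty on x exactly when they are empty on y (a product with an
-- empty factor is empty, while 0 · n = 0 only needs the other factor to be
-- inhabited).  Sums and products of positive numbers never decrease, so
-- nothing above c influences the segment [0, c].
--
-- The test inputs are Evens n = {0, 2, …, 2n}; Evens i and Evens j (i < j) agree
-- on [0, 2i + 1].  A circuit with s product factors has at most 2^s emptiness
-- profiles, so (classically, i.e. under a double negation, which suffices to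
-- derive ⊥) two of the inputs Evens 0, …, Evens 2^s share a profile.  The
-- circuit then confuses them on [0, 2i + 1], whereas ⇓, Max and Card separate
-- them there by 2i + 1, 2i and i + 1 respectively.
module Submission where

open import Defs
open import Data.Empty using (⊥-elim)
open import Data.Fin using (Fin; zero; suc; toℕ; funToFin; finToFun)
open import Data.Fin.Properties using (pigeonhole; finToFun-funToFin)
open import Data.List using (List; []; _∷_; length; lookup; applyUpTo; _++_)
open import Data.List.Properties using (tabulate-lookup; length-applyUpTo)
open import Data.List.Membership.Propositional using () renaming (_∈_ to _∈ₗ_)
open import Data.List.Membership.Propositional.Properties using (∈-applyUpTo⁺; ∈-applyUpTo⁻)
open import Data.List.Relation.Unary.All as All using (All; _∷_)
open import Data.List.Relation.Unary.All.Properties using (++⁻ˡ; ++⁻ʳ; tabulate⁺)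
open import Data.List.Relation.Unary.Unique.Propositional.Properties using (applyUpTo⁺₁)
open import Data.Nat using (ℕ; zero; suc; _*_; _^_; _≤_; _<_; z≤n; s≤s; s≤s⁻¹)
open import Data.Nat.Properties
open import Data.Product using (Σ; _×_; _,_; proj₁; proj₂)
import Data.Product as Product
import Data.Sum as Sum
open import Data.Unit using (tt)
open import Function using (_∘_; id)
open import Function.Bundles using (_⇔_; mk⇔; Equivalence)
open import Function.Construct.Symmetry using (⇔-sym)
open import Relation.Nullary using (¬_; Dec; yes; no)
open import Relation.Nullary.Decidable using (¬¬-excluded-middle)
open import Relation.Nullary.Negation using (¬¬-map)
open import Relation.Binary.PropositionalEquality using (_≡_; refl; sym; trans; cong; subst)
open import Relation.Unary using (_∈_; Satisfiable)

open Equivalence using (to; from)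

_⊆[_]_ : SetN → ℕ → SetN → Set
x ⊆[ c ] y = ∀ k → k ≤ c → k ∈ x → k ∈ y

_≈[_]_ : SetN → ℕ → SetN → Set
x ≈[ c ] y = ∀ k → k ≤ c → (k ∈ x ⇔ k ∈ y)

≈-sym : ∀ {x y c} → x ≈[ c ] y → y ≈[ c ] x
≈-sym x≈y k k≤c = ⇔-sym (x≈y k k≤c)

-- A summand of k is at most k, so ⊕ respects windows.
⊕-window : ∀ {a a′ b b′ c} → a ⊆[ c ] a′ → b ⊆[ c ] b′ → (a ⊕ b) ⊆[ c ] (a′ ⊕ b′)
⊕-window a⊆ b⊆ _ k≤c (m , n , m∈ , n∈ , refl) =
  m , n , a⊆ m (≤-trans (m≤m+n m n) k≤c) m∈ , b⊆ n (≤-trans (m≤n+m n m) k≤c) n∈ , refl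

-- A factor of a positive product is at most the product; the product 0 · n
-- only needs some witness n, hence the hypotheses on inhabitation.
⊗-window : ∀ {a a′ b b′ c} → a ⊆[ c ] a′ → b ⊆[ c ] b′ →
           (Satisfiable a → Satisfiable a′) → (Satisfiable b → Satisfiable b′) →
           (a ⊗ b) ⊆[ c ] (a′ ⊗ b′)
⊗-window a⊆ b⊆ _ b-inh _ _ (zero , n , m∈ , n∈ , refl)
  with n′ , n′∈ ← b-inh (n , n∈) = 0 , n′ , a⊆ 0 z≤n m∈ , n′∈ , refl
⊗-window a⊆ b⊆ a-inh _ _ _ (suc m , zero , m∈ , n∈ , refl)
  with m′ , m′∈ ← a-inh (suc m , m∈) =
  m′ , 0 , m′∈ , b⊆ 0 z≤n n∈ , trans (*-zeroʳ (suc m)) (sym (*-zeroʳ m′))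
⊗-window a⊆ b⊆ _ _ _ k≤c (suc m , suc n , m∈ , n∈ , refl) =
  suc m , suc n ,
  a⊆ (suc m) (≤-trans (m≤m*n (suc m) (suc n)) k≤c) m∈ ,
  b⊆ (suc n) (≤-trans (m≤n*m (suc n) (suc m)) k≤c) n∈ , refl

-- The subcircuits occurring as factors of a product: the only places where
-- the behaviour of a circuit depends on more than a window of its input.
factors : Circuit → List Circuit
factors (cup a b)   = factors a ++ factors b
factors (cap a b)   = factors a ++ factors b
factors (compl a)   = factors a
factors (plus a b)  = factors a ++ factors b
factors (times a b) = a ∷ b ∷ factors a ++ factors b
factors _           = []

SameEmptiness : SetN → SetN → Circuit → Set
SameEmptiness x y σ = Satisfiable (⟦ σ ⟧ x) ⇔ Satisfiable (⟦ σ ⟧ y)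

-- Window lemma, one inclusion; complement swaps the roles of x and y.
window : ∀ τ {c x y} → x ≈[ c ] y → All (SameEmptiness x y) (factors τ) →
         ⟦ τ ⟧ x ⊆[ c ] ⟦ τ ⟧ y
window var       x≈y _ k k≤c = to (x≈y k k≤c)
window emp       _   _ _ _   = id
window nat       _   _ _ _ _ = tt
window (const n) _   _ _ _   = id
window (cup a b) x≈y e k k≤c =
  Sum.map (window a x≈y (++⁻ˡ (factors a) e) k k≤c) (window b x≈y (++⁻ʳ (factors a) e) k k≤c)
window (cap a b) x≈y e k k≤c =
  Product.map (window a x≈y (++⁻ˡ (factors a) e) k k≤c) (window b x≈y (++⁻ʳ (factors a) e) k k≤c)
window (compl a) x≈y e k k≤c k∉ k∈ = k∉ (window a (≈-sym x≈y) (All.map ⇔-sym e) k k≤c k∈)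
window (plus a b) x≈y e =
  ⊕-window (window a x≈y (++⁻ˡ (factors a) e)) (window b x≈y (++⁻ʳ (factors a) e))
window (times a b) x≈y (ea ∷ eb ∷ e) =
  ⊗-window (window a x≈y (++⁻ˡ (factors a) e)) (window b x≈y (++⁻ʳ (factors a) e)) (to ea) (to eb)

window-≈ : ∀ τ {c x y} → x ≈[ c ] y → All (SameEmptiness x y) (factors τ) →
           ⟦ τ ⟧ x ≈[ c ] ⟦ τ ⟧ y
window-≈ τ x≈y e k k≤c =
  mk⇔ (window τ x≈y e k k≤c) (window τ (≈-sym x≈y) (All.map ⇔-sym e) k k≤c)

¬¬-finite : ∀ {n} {P : Fin n → Set} → (∀ r → ¬ ¬ P r) → ¬ ¬ (∀ r → P r)
¬¬-finite {zero}  _ k = k (λ ())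
¬¬-finite {suc n} h k =
  h zero λ p₀ → ¬¬-finite (h ∘ suc) λ ps → k λ { zero → p₀ ; (suc r) → ps r }

bit : {A : Set} → Dec A → Fin 2
bit (yes _) = zero
bit (no _)  = suc zero

bit-⇔ : {A B : Set} (a : Dec A) (b : Dec B) → bit a ≡ bit b → A ⇔ B
bit-⇔ (yes a) (yes b) _ = mk⇔ (λ _ → b) (λ _ → a)
bit-⇔ (no ¬a) (no ¬b) _ = mk⇔ (⊥-elim ∘ ¬a) (⊥-elim ∘ ¬b)
bit-⇔ (yes _) (no _)  ()
bit-⇔ (no _)  (yes _) ()

funToFin-injective : ∀ {m n} (f g : Fin m → Fin n) → funToFin f ≡ funToFin g → ∀ r → f r ≡ g r
funToFin-injective f g eq r =
  trans (sym (finToFun-funToFin f r)) (trans (cong (λ i → finToFun i r) eq) (finToFun-funToFin g r))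

profile-pigeonhole : ∀ n (P : ℕ → Fin n → Set) →
                     ¬ ¬ (Σ ℕ λ i → Σ ℕ λ j → i < j × (∀ r → P i r ⇔ P j r))
profile-pigeonhole n P = ¬¬-map collide (¬¬-finite λ _ → ¬¬-finite λ _ → ¬¬-excluded-middle)
  where
  collide : ((k : Fin (suc (2 ^ n))) (r : Fin n) → Dec (P (toℕ k) r)) →
            Σ ℕ λ i → Σ ℕ λ j → i < j × (∀ r → P i r ⇔ P j r)
  collide decide
    with i , j , i<j , same ← pigeonhole (n<1+n (2 ^ n)) (λ k → funToFin (bit ∘ decide k))
    = toℕ i , toℕ j , i<j , λ r → bit-⇔ (decide i r) (decide j r) (funToFin-injective _ _ same r)

list-profile-pigeonhole : {A : Set} (as : List A) (P : ℕ → A → Set) →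
  ¬ ¬ (Σ ℕ λ i → Σ ℕ λ j → i < j × All (λ a → P i a ⇔ P j a) as)
list-profile-pigeonhole as P =
  ¬¬-map (λ (i , j , i<j , same) → i , j , i<j , subst (All _) (tabulate-lookup as) (tabulate⁺ same))
         (profile-pigeonhole (length as) (λ i r → P i (lookup as r)))

evens : ℕ → List ℕ
evens n = applyUpTo (2 *_) (suc n)

Evens : ℕ → SetN
Evens n k = k ∈ₗ evens n

even∈Evens : ∀ {t n} → t ≤ n → 2 * t ∈ Evens n
even∈Evens t≤n = ∈-applyUpTo⁺ (2 *_) (s≤s t≤n)

Evens-even : ∀ {k n} → k ∈ Evens n → Σ ℕ λ t → t ≤ n × k ≡ 2 * t
Evens-even k∈ with t , t<1+n , k≡2t ← ∈-applyUpTo⁻ (2 *_) k∈ = t , s≤s⁻¹ t<1+n , k≡2t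

Evens-max : ∀ n → IsMax (Evens n) (2 * n)
Evens-max n = even∈Evens ≤-refl , bounded
  where
  bounded : ∀ k → k ∈ Evens n → k ≤ 2 * n
  bounded k k∈ with t , t≤n , refl ← Evens-even k∈ = *-monoʳ-≤ 2 t≤n

evens-length : ∀ n → length (evens n) ≡ suc n
evens-length n = length-applyUpTo (2 *_) (suc n)

Evens-enumerated : ∀ n → Enumerates (evens n) (Evens n)
Evens-enumerated n =
  applyUpTo⁺₁ (2 *_) (suc n) (λ i<j _ → <⇒≢ (*-monoʳ-< 2 i<j)) , λ _ → mk⇔ id id

half-≤ : ∀ t i → 2 * t ≤ suc (2 * i) → t ≤ i
half-≤ t i 2t≤ = s≤s⁻¹ (*-cancelˡ-< 2 t (suc i) (subst (2 * t <_) (sym (*-suc 2 i)) (s≤s 2t≤)))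

Evens-agree : ∀ {i j} → i ≤ j → Evens i ≈[ suc (2 * i) ] Evens j
Evens-agree {i} {j} i≤j k k≤c = mk⇔ up down
  where
  up : k ∈ Evens i → k ∈ Evens j
  up k∈ with t , t≤i , refl ← Evens-even k∈ = even∈Evens (≤-trans t≤i i≤j)
  down : k ∈ Evens j → k ∈ Evens i
  down k∈ with t , _ , refl ← Evens-even k∈ = even∈Evens (half-≤ t i k≤c)

confusion : ∀ τ → ¬ ¬ (Σ ℕ λ i → Σ ℕ λ j →
              i < j × ⟦ τ ⟧ (Evens i) ≈[ suc (2 * i) ] ⟦ τ ⟧ (Evens j))
confusion τ =
  ¬¬-map (λ (i , j , i<j , same) → i , j , i<j , window-≈ τ (Evens-agree (<⇒≤ i<j)) same)
         (list-profile-pigeonhole (factors τ) (λ i σ → Satisfiable (⟦ σ ⟧ (Evens i))))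

down-undefinable : ¬ Σ Circuit DefinesDown
down-undefinable (τ , D) = confusion τ λ (i , j , i<j , same) →
  let in-j : suc (2 * i) ∈ ⟦ τ ⟧ (Evens j)
      in-j = proj₂ (D (Evens j)) (2 * j , even∈Evens ≤-refl , *-monoʳ-< 2 i<j)
      (n , n∈ , 2i<n) = proj₁ (D (Evens i)) (from (same _ ≤-refl) in-j)
  in <⇒≱ 2i<n (proj₂ (Evens-max i) n n∈)

max-undefinable : ¬ Σ Circuit DefinesMax
max-undefinable (τ , M) = confusion τ λ (i , j , i<j , same) →
  let in-i : 2 * i ∈ ⟦ τ ⟧ (Evens i)
      in-i = proj₂ (proj₂ (proj₂ (M (Evens i))) (2 * i) (Evens-max i)) refl
      2j≡2i : 2 * j ≡ 2 * i
      2j≡2i = proj₁ (proj₂ (proj₂ (M (Evens j))) (2 * j) (Evens-max j)) (to (same _ (n≤1+n _)) in-i)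
  in <⇒≢ (*-monoʳ-< 2 i<j) (sym 2j≡2i)

card-undefinable : ¬ Σ Circuit DefinesCard
card-undefinable (τ , C) = confusion τ λ (i , j , i<j , same) →
  let in-i : length (evens i) ∈ ⟦ τ ⟧ (Evens i)
      in-i = proj₂ (proj₁ (C (Evens i)) (evens i) (Evens-enumerated i)) refl
      bound : length (evens i) ≤ suc (2 * i)
      bound = subst (_≤ suc (2 * i)) (sym (evens-length i)) (s≤s (m≤n*m i 2))
      len≡ : length (evens j) ≡ length (evens i)
      len≡ = proj₁ (proj₁ (C (Evens j)) (evens j) (Evens-enumerated j)) (to (same _ bound) in-i)
  in <⇒≢ (s≤s i<j) (trans (sym (evens-length i)) (trans (sym len≡) (evens-length j)))

corollary1 : (¬ Σ Circuit DefinesDown) × (¬ Σ Circuit DefinesMax) × (¬ Σ Circuit DefinesCard)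
corollary1 = down-undefinable , max-undefinable , card-undefinable
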